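{- Let $k$ be a positive integer and let $\chi$ and $\psi$ be real Dirichlet characters modulo $L$ and $M$, respectively. If $\chi(-1)\psi(-1)=(-1)^k$, then \[ R_k(X;\chi,\psi)=\psi(-1)\,X^{k-2}\,R_k(X^{ -1};\chi,\psi). \]
   Context: Generalized Bernoulli numbers of a Dirichlet character $\chi$ modulo $L$ are defined by $\sum_{n\ge0}B_{n,\chi}\frac{x^n}{n!}=\sum_{a=1}^L\frac{\chi(a)xe^{ax}}{e^{Lx}-1}$. For Dirichlet characters $\chi$ modulo $L$ and $\psi$ modulo $M$, the generalized Ramanujan (Laurent) polynomial is \[ R_k(X;\chi,\psi)=\sum_{s=0}^{k}\frac{B_{s,\chi}}{s!}\frac{B_{k-s,\psi}}{(k-s)!}\Big(\frac{X-1}{M}\Big)^{k-s-1}\big(1-X^{s-1}\big). \] A Dirichlet character is real if all its values are real. -}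

module Defs where

open import Data.Nat as ℕ using (ℕ; zero; suc; _!)
open import Data.Integer as ℤ using (ℤ; +_; -[1+_])
open import Data.Integer.GCD as ℤG using ()
open import Data.Rational as ℚ using (ℚ; 0ℚ; 1ℚ; _+_; _*_; _-_; -_; 1/_; _≟_)
open import Data.Rational.Base using (≢-nonZero)
open import Data.List using (List; map; upTo; foldr)
open import Relation.Binary.PropositionalEquality using (_≡_; _≢_)
open import Relation.Nullary using (yes; no)
open import Data.Product using (_×_)
open import Function.Bundles using (_⇔_)

Σ₀ : ℕ → (ℕ → ℚ) → ℚ
Σ₀ n f = foldr _+_ 0ℚ (map f (upTo (suc n)))

Σ₁ : ℕ → (ℕ → ℚ) → ℚ
Σ₁ n f = foldr _+_ 0ℚ (map (λ i → f (suc i)) (upTo n))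

ℕ→ℚ : ℕ → ℚ
ℕ→ℚ n = (+ n) ℚ./ 1

ℤ→ℚ : ℤ → ℚ
ℤ→ℚ z = z ℚ./ 1

_^ℕ_ : ℚ → ℕ → ℚ
x ^ℕ zero = 1ℚ
x ^ℕ suc n = x * (x ^ℕ n)

-- inverse, totalised by 1/0 := 0 (only used at nonzero arguments)
inv : ℚ → ℚ
inv x with x ≟ 0ℚ
... | yes _ = 0ℚ
... | no p = (1/ x) {{≢-nonZero p}}

_^ℤ_ : ℚ → ℤ → ℚ
x ^ℤ (+ n) = x ^ℕ n
x ^ℤ -[1+ n ] = inv x ^ℕ suc n

-- A Dirichlet character modulo L, with values in ℚ.
-- (ℚ-valued Dirichlet characters are exactly the real Dirichlet characters,
-- whose values lie in {-1, 0, 1}.)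
record IsDirichletCharacter (L : ℕ) (χ : ℤ → ℚ) : Set where
  field
    periodic       : ∀ a → χ (a ℤ.+ + L) ≡ χ a
    multiplicative : ∀ a b → χ (a ℤ.* b) ≡ χ a * χ b
    one            : χ (+ 1) ≡ 1ℚ
    zero-iff       : ∀ a → (χ a ≡ 0ℚ) ⇔ (ℤG.gcd a (+ L) ≢ + 1)

-- B is the sequence of generalized Bernoulli numbers B_{n,χ} of χ mod L:
--   Σ_n B n x^n/n! = Σ_{a=1}^{L} χ(a) x e^{ax} / (e^{Lx} - 1),
-- written as the equality of power series
--   (e^{Lx} - 1) · Σ_n B n x^n/n! = Σ_{a=1}^{L} χ(a) x e^{ax},
-- i.e. comparing coefficients of x^{n+1} for every n:
--   Σ_{j=1}^{n+1} L^j/j! · B(n+1-j)/(n+1-j)! = Σ_{a=1}^{L} χ(a) a^n / n!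
-- (the coefficient of x^0 is 0 on both sides).
IsGenBernoulli : (L : ℕ) → (χ : ℤ → ℚ) → (B : ℕ → ℚ) → Set
IsGenBernoulli L χ B = ∀ n →
  Σ₁ (suc n) (λ j → (ℕ→ℚ (L ℕ.^ j) * inv (ℕ→ℚ (j !)))
                   * (B (suc n ℕ.∸ j) * inv (ℕ→ℚ ((suc n ℕ.∸ j) !))))
  ≡ Σ₁ L (λ a → χ (+ a) * ℕ→ℚ (a ℕ.^ n) * inv (ℕ→ℚ (n !)))

-- Generalized Ramanujan (Laurent) polynomial evaluated at X ∈ ℚ (X ∉ {0,1}):
-- R_k(X;χ,ψ) = Σ_{s=0}^{k} B_{s,χ}/s! · B_{k-s,ψ}/(k-s)! · ((X-1)/M)^{k-s-1} (1 - X^{s-1})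
-- Bχ, Bψ are the generalized Bernoulli numbers of χ (mod L) and ψ (mod M).
R : (k : ℕ) → (Bχ Bψ : ℕ → ℚ) → (M : ℕ) → ℚ → ℚ
R k Bχ Bψ M X = Σ₀ k (λ s →
    (Bχ s * inv (ℕ→ℚ (s !))) * (Bψ (k ℕ.∸ s) * inv (ℕ→ℚ ((k ℕ.∸ s) !)))
    * (((X - 1ℚ) * inv (ℕ→ℚ M)) ^ℤ ((+ k ℤ.- + s) ℤ.- + 1))
    * (1ℚ - X ^ℤ (+ s ℤ.- + 1)))

module Submission where

-- The identity holds summand by summand.  Writing c_s = B_{s,χ}/s! · B_{k-s,ψ}/(k-s)!,
-- X^{k-2} times the s-th summand at 1/X is (-1)^{k+s} times the s-th summand at X; this
-- is an identity of Laurent monomials in X (section "Reflection of one summand").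
-- For s = 1 both summands vanish, because of the factor 1 - X^0.  For s ≠ 1
-- it remains to show ψ(-1)(-1)^{k+s} c_s = c_s, which follows from the PARITY of
-- generalized Bernoulli numbers, (-1)^n B_{n,χ} = χ(-1) B_{n,χ} for n ≠ 1, applied to
-- B_{k-s,ψ}, or to B_{s,χ} when k - s = 1 (using χ(-1)ψ(-1) = (-1)^k, ψ(-1)² = 1).
--
-- Parity is proved with formal power series, represented by their coefficient sequences
-- and multiplied by the Cauchy product _⋆_.  With F = Σ B_{n,χ} xⁿ/n!, T = (e^{Lx}-1)/x
-- and N = Σ_{a=1}^{L} χ(a) e^{ax}, the definition of B_{n,χ} says T ⋆ F = N.  Replacing
-- x by -x and reflecting a ↦ L - a shows T ⋆ D = 0 for D = F(-x) - χ(-1)F + χ(-1)χ(0)x;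
-- as T has the nonzero constant term L, D = 0, which is parity.

open import Defs
open import Data.Nat as ℕ using (ℕ; zero; suc; NonZero; _!; _<_; _≤_; s≤s; z≤n)
open import Data.Nat.Induction using (<-rec)
open import Data.Integer as ℤ using (ℤ; -[1+_]; _⊖_) renaming (+_ to pos)
open import Data.Rational as ℚ using (ℚ; mkℚ; 0ℚ; 1ℚ; _+_; _*_; _-_; -_; _≟_)
import Data.Rational.Properties as ℚP
import Data.Integer.Properties as ℤP
import Data.Nat.Properties as ℕP
open import Data.Nat.Coprimality using (1-coprimeTo)
open import Data.Nat.Combinatorics using (_C_; nCk≡n!/k![n-k]!; k![n∸k]!∣n!)
open import Data.Nat.DivMod using (m/n*n≡m)
open import Data.List using (map; foldr; applyUpTo)
open import Data.Fin using (toℕ)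
open import Relation.Binary.PropositionalEquality
open import Relation.Nullary using (yes; no)
open import Data.Empty using (⊥-elim)
open import Algebra.Bundles using (module CommutativeRing)
import Algebra.Definitions.RawMonoid
import Algebra.Properties.Semiring.Binomial as Binomial
open import Data.Rational.Solver using (module +-*-Solver)
open +-*-Solver

-- Arithmetic in ℚ

ℕ→ℚ≡mkℚ : ∀ n → ℕ→ℚ n ≡ mkℚ (pos n) 0 (Data.Nat.Coprimality.sym (1-coprimeTo n))
ℕ→ℚ≡mkℚ n = ℚP.normalize-coprime _

ℕ→ℚ-+ : ∀ m n → ℕ→ℚ m + ℕ→ℚ n ≡ ℕ→ℚ (m ℕ.+ n)
ℕ→ℚ-+ m n rewrite ℕ→ℚ≡mkℚ m | ℕ→ℚ≡mkℚ n | ℤP.*-identityʳ (pos m) | ℤP.*-identityʳ (pos n) = refl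

ℕ→ℚ-* : ∀ m n → ℕ→ℚ m * ℕ→ℚ n ≡ ℕ→ℚ (m ℕ.* n)
ℕ→ℚ-* m n rewrite ℕ→ℚ≡mkℚ m | ℕ→ℚ≡mkℚ n = cong (λ z → z ℚ./ 1) (sym (ℤP.pos-* m n))

ℕ→ℚ-^ : ∀ a n → ℕ→ℚ (a ℕ.^ n) ≡ ℕ→ℚ a ^ℕ n
ℕ→ℚ-^ a zero = refl
ℕ→ℚ-^ a (suc n) = trans (sym (ℕ→ℚ-* a (a ℕ.^ n))) (cong (ℕ→ℚ a *_) (ℕ→ℚ-^ a n))

ℕ→ℚ-∸ : ∀ m n → n ≤ m → ℕ→ℚ (m ℕ.∸ n) ≡ ℕ→ℚ m - ℕ→ℚ n
ℕ→ℚ-∸ m n n≤m = begin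
    ℕ→ℚ (m ℕ.∸ n)
  ≡⟨ solve 2 (λ a b → a := (a :+ b) :- b) refl (ℕ→ℚ (m ℕ.∸ n)) (ℕ→ℚ n) ⟩
    (ℕ→ℚ (m ℕ.∸ n) + ℕ→ℚ n) - ℕ→ℚ n
  ≡⟨ cong (_- ℕ→ℚ n) (trans (ℕ→ℚ-+ (m ℕ.∸ n) n) (cong ℕ→ℚ (ℕP.m∸n+n≡m n≤m))) ⟩
    ℕ→ℚ m - ℕ→ℚ n ∎
  where open ≡-Reasoning

ℕ→ℚ-≢0 : ∀ n → .{{NonZero n}} → ℕ→ℚ n ≢ 0ℚ
ℕ→ℚ-≢0 (suc n) eq with trans (sym (ℕ→ℚ≡mkℚ (suc n))) eq
... | ()

n!≢0 : ∀ n → ℕ→ℚ (n !) ≢ 0ℚ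
n!≢0 n = ℕ→ℚ-≢0 (n !) {{n ℕP.!≢0}}

inv-inverseˡ : ∀ x → x ≢ 0ℚ → inv x * x ≡ 1ℚ
inv-inverseˡ x x≢0 with x ≟ 0ℚ
... | yes x≡0 = ⊥-elim (x≢0 x≡0)
... | no x≢0′ = ℚP.*-inverseˡ x {{ℚ.≢-nonZero x≢0′}}

inv-inverseʳ : ∀ x → x ≢ 0ℚ → x * inv x ≡ 1ℚ
inv-inverseʳ x x≢0 = trans (ℚP.*-comm x (inv x)) (inv-inverseˡ x x≢0)

invertible⇒≢0 : ∀ x y → x * y ≡ 1ℚ → x ≢ 0ℚ
invertible⇒≢0 x y xy≡1 refl with trans (sym xy≡1) (ℚP.*-zeroˡ y)
... | ()

inv-unique : ∀ x y → x * y ≡ 1ℚ → inv x ≡ y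
inv-unique x y xy≡1 = begin
    inv x                ≡⟨ sym (ℚP.*-identityʳ (inv x)) ⟩
    inv x * 1ℚ           ≡⟨ cong (inv x *_) (sym xy≡1) ⟩
    inv x * (x * y)      ≡⟨ sym (ℚP.*-assoc (inv x) x y) ⟩
    (inv x * x) * y      ≡⟨ cong (_* y) (inv-inverseˡ x (invertible⇒≢0 x y xy≡1)) ⟩
    1ℚ * y               ≡⟨ ℚP.*-identityˡ y ⟩
    y ∎
  where open ≡-Reasoning

inv-1 : inv 1ℚ ≡ 1ℚ
inv-1 = inv-unique 1ℚ 1ℚ refl

inv-* : ∀ x y → x ≢ 0ℚ → y ≢ 0ℚ → inv (x * y) ≡ inv x * inv y
inv-* x y x≢0 y≢0 = inv-unique (x * y) (inv x * inv y) (begin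
    (x * y) * (inv x * inv y)  ≡⟨ solve 4 (λ x y x' y' → (x :* y) :* (x' :* y') := (x :* x') :* (y :* y')) refl x y (inv x) (inv y) ⟩
    (x * inv x) * (y * inv y)  ≡⟨ cong₂ _*_ (inv-inverseʳ x x≢0) (inv-inverseʳ y y≢0) ⟩
    1ℚ ∎)
  where open ≡-Reasoning

*-cancel-≡0 : ∀ x y → x ≢ 0ℚ → x * y ≡ 0ℚ → y ≡ 0ℚ
*-cancel-≡0 x y x≢0 xy≡0 = begin
    y                   ≡⟨ sym (ℚP.*-identityˡ y) ⟩
    1ℚ * y              ≡⟨ cong (_* y) (sym (inv-inverseˡ x x≢0)) ⟩
    (inv x * x) * y     ≡⟨ ℚP.*-assoc (inv x) x y ⟩
    inv x * (x * y)     ≡⟨ cong (inv x *_) xy≡0 ⟩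
    inv x * 0ℚ          ≡⟨ ℚP.*-zeroʳ (inv x) ⟩
    0ℚ ∎
  where open ≡-Reasoning

-- Signs (-1)ⁿ, defined by recursion so that sgn (suc n) = - sgn n holds definitionally.
sgn : ℕ → ℚ
sgn zero = 1ℚ
sgn (suc n) = - sgn n

sgn-+ : ∀ m n → sgn (m ℕ.+ n) ≡ sgn m * sgn n
sgn-+ zero n = sym (ℚP.*-identityˡ _)
sgn-+ (suc m) n = trans (cong -_ (sgn-+ m n)) (ℚP.neg-distribˡ-* (sgn m) (sgn n))

sgn-sq : ∀ n → sgn n * sgn n ≡ 1ℚ
sgn-sq zero = refl
sgn-sq (suc n) = trans (solve 1 (λ s → (:- s) :* (:- s) := s :* s) refl (sgn n)) (sgn-sq n)

^ℕ-neg : ∀ c n → (- c) ^ℕ n ≡ sgn n * c ^ℕ n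
^ℕ-neg c zero = refl
^ℕ-neg c (suc n) = trans (cong ((- c) *_) (^ℕ-neg c n))
  (solve 3 (λ c s p → (:- c) :* (s :* p) := (:- s) :* (c :* p)) refl c (sgn n) (c ^ℕ n))

^ℕ-* : ∀ a b n → (a * b) ^ℕ n ≡ a ^ℕ n * b ^ℕ n
^ℕ-* a b zero = refl
^ℕ-* a b (suc n) = trans (cong ((a * b) *_) (^ℕ-* a b n))
  (solve 4 (λ a b p q → (a :* b) :* (p :* q) := (a :* p) :* (b :* q)) refl a b (a ^ℕ n) (b ^ℕ n))

1^ℕ : ∀ n → 1ℚ ^ℕ n ≡ 1ℚ
1^ℕ zero = refl
1^ℕ (suc n) = trans (ℚP.*-identityˡ _) (1^ℕ n)

^ℕ-inverse : ∀ x y → x * y ≡ 1ℚ → ∀ n → x ^ℕ n * y ^ℕ n ≡ 1ℚ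
^ℕ-inverse x y xy≡1 n = trans (sym (^ℕ-* x y n)) (trans (cong (_^ℕ n) xy≡1) (1^ℕ n))

sgn≡-1^ : ∀ k → (- 1ℚ) ^ℕ k ≡ sgn k
sgn≡-1^ k = trans (^ℕ-neg 1ℚ k) (trans (cong (sgn k *_) (1^ℕ k)) (ℚP.*-identityʳ _))

-- Finite sums

Σ< : ℕ → (ℕ → ℚ) → ℚ
Σ< zero f = 0ℚ
Σ< (suc n) f = f 0 + Σ< n (λ i → f (suc i))

foldr-applyUpTo : ∀ n (f : ℕ → ℚ) (g : ℕ → ℕ) →
  foldr _+_ 0ℚ (map f (applyUpTo g n)) ≡ Σ< n (λ i → f (g i))
foldr-applyUpTo zero f g = refl
foldr-applyUpTo (suc n) f g = cong (f (g 0) +_) (foldr-applyUpTo n f (λ i → g (suc i)))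

Σ₀≡Σ< : ∀ n f → Σ₀ n f ≡ Σ< (suc n) f
Σ₀≡Σ< n f = foldr-applyUpTo (suc n) f (λ i → i)

Σ₁≡Σ< : ∀ n f → Σ₁ n f ≡ Σ< n (λ i → f (suc i))
Σ₁≡Σ< n f = foldr-applyUpTo n (λ i → f (suc i)) (λ i → i)

Σ<-cong : ∀ n {f g : ℕ → ℚ} → (∀ i → i < n → f i ≡ g i) → Σ< n f ≡ Σ< n g
Σ<-cong zero f≡g = refl
Σ<-cong (suc n) f≡g = cong₂ _+_ (f≡g 0 (s≤s z≤n)) (Σ<-cong n (λ i i<n → f≡g (suc i) (s≤s i<n)))

Σ<-+ : ∀ n (f g : ℕ → ℚ) → Σ< n (λ i → f i + g i) ≡ Σ< n f + Σ< n g
Σ<-+ zero f g = refl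
Σ<-+ (suc n) f g = trans (cong (f 0 + g 0 +_) (Σ<-+ n _ _))
  (solve 4 (λ a b c d → (a :+ b) :+ (c :+ d) := (a :+ c) :+ (b :+ d)) refl (f 0) (g 0) _ _)

Σ<-*ˡ : ∀ n c (f : ℕ → ℚ) → Σ< n (λ i → c * f i) ≡ c * Σ< n f
Σ<-*ˡ zero c f = sym (ℚP.*-zeroʳ c)
Σ<-*ˡ (suc n) c f = trans (cong (c * f 0 +_) (Σ<-*ˡ n c _)) (sym (ℚP.*-distribˡ-+ c (f 0) _))

Σ<-0 : ∀ n → Σ< n (λ _ → 0ℚ) ≡ 0ℚ
Σ<-0 zero = refl
Σ<-0 (suc n) = trans (ℚP.+-identityˡ _) (Σ<-0 n)

Σ<-last : ∀ n f → Σ< (suc n) f ≡ Σ< n f + f n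
Σ<-last zero f = trans (ℚP.+-identityʳ (f 0)) (sym (ℚP.+-identityˡ (f 0)))
Σ<-last (suc n) f = trans (cong (f 0 +_) (Σ<-last n (λ i → f (suc i))))
  (sym (ℚP.+-assoc (f 0) _ _))

-- Summing in reverse order; used for the reflection a ↦ L - a.
Σ<-reverse : ∀ n f → Σ< n f ≡ Σ< n (λ i → f (n ℕ.∸ suc i))
Σ<-reverse zero f = refl
Σ<-reverse (suc n) f =
  trans (Σ<-last n f) (trans (cong (_+ f n) (Σ<-reverse n f)) (ℚP.+-comm _ (f n)))

Σ<-swap : ∀ n m (F : ℕ → ℕ → ℚ) →
  Σ< n (λ i → Σ< m (λ j → F i j)) ≡ Σ< m (λ j → Σ< n (λ i → F i j))
Σ<-swap zero m F = sym (Σ<-0 m)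
Σ<-swap (suc n) m F = trans (cong (Σ< m (F 0) +_) (Σ<-swap n m (λ i → F (suc i))))
  (sym (Σ<-+ m (F 0) (λ j → Σ< n (λ i → F (suc i) j))))

-- Formal power series

Seq : Set
Seq = ℕ → ℚ

infixl 7 _⋆_
_⋆_ : Seq → Seq → Seq
(f ⋆ g) n = Σ< (suc n) (λ j → f j * g (n ℕ.∸ j))

-- (f - f 0)/x, multiplication by x, the unit series 1, and f(x) ↦ f(-x).
tail : Seq → Seq
tail f i = f (suc i)

shift : Seq → Seq
shift f zero = 0ℚ
shift f (suc i) = f i

δ : Seq
δ zero = 1ℚ
δ (suc _) = 0ℚ

twist : Seq → Seq
twist f n = sgn n * f n

⋆-congˡ : ∀ {f f′} g → (∀ i → f i ≡ f′ i) → ∀ n → (f ⋆ g) n ≡ (f′ ⋆ g) n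
⋆-congˡ g f≡f′ n = Σ<-cong (suc n) (λ i _ → cong (_* g (n ℕ.∸ i)) (f≡f′ i))

⋆-congʳ : ∀ f {g g′} → (∀ i → g i ≡ g′ i) → ∀ n → (f ⋆ g) n ≡ (f ⋆ g′) n
⋆-congʳ f g≡g′ n = Σ<-cong (suc n) (λ i _ → cong (f i *_) (g≡g′ (n ℕ.∸ i)))

⋆-distribʳ-+ : ∀ f f′ g n → ((λ i → f i + f′ i) ⋆ g) n ≡ (f ⋆ g) n + (f′ ⋆ g) n
⋆-distribʳ-+ f f′ g n =
  trans (Σ<-cong (suc n) (λ i _ → ℚP.*-distribʳ-+ (g (n ℕ.∸ i)) (f i) (f′ i)))
        (Σ<-+ (suc n) (λ i → f i * g (n ℕ.∸ i)) (λ i → f′ i * g (n ℕ.∸ i)))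

⋆-distribˡ-+ : ∀ f g g′ n → (f ⋆ (λ i → g i + g′ i)) n ≡ (f ⋆ g) n + (f ⋆ g′) n
⋆-distribˡ-+ f g g′ n =
  trans (Σ<-cong (suc n) (λ i _ → ℚP.*-distribˡ-+ (f i) (g (n ℕ.∸ i)) (g′ (n ℕ.∸ i))))
        (Σ<-+ (suc n) (λ i → f i * g (n ℕ.∸ i)) (λ i → f i * g′ (n ℕ.∸ i)))

⋆-scaleˡ : ∀ c f g n → ((λ i → c * f i) ⋆ g) n ≡ c * (f ⋆ g) n
⋆-scaleˡ c f g n = trans (Σ<-cong (suc n) (λ i _ → ℚP.*-assoc c (f i) (g (n ℕ.∸ i))))
  (Σ<-*ˡ (suc n) c (λ i → f i * g (n ℕ.∸ i)))

⋆-scaleʳ : ∀ c f g n → (f ⋆ (λ i → c * g i)) n ≡ c * (f ⋆ g) n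
⋆-scaleʳ c f g n = trans (Σ<-cong (suc n) (λ i _ →
    solve 3 (λ a b d → a :* (b :* d) := b :* (a :* d)) refl (f i) c (g (n ℕ.∸ i))))
  (Σ<-*ˡ (suc n) c (λ i → f i * g (n ℕ.∸ i)))

⋆-Σ<ʳ : ∀ f m (G : ℕ → Seq) n → (f ⋆ (λ k → Σ< m (λ a → G a k))) n ≡ Σ< m (λ a → (f ⋆ G a) n)
⋆-Σ<ʳ f m G n = trans (Σ<-cong (suc n) (λ i _ → sym (Σ<-*ˡ m (f i) (λ a → G a (n ℕ.∸ i)))))
  (Σ<-swap (suc n) m (λ i a → f i * G a (n ℕ.∸ i)))

-- Associativity, by induction on n using (f ⋆ g)(n+1) = f 0 · g (n+1) + (tail f ⋆ g) n.
⋆-assoc : ∀ n f g h → ((f ⋆ g) ⋆ h) n ≡ (f ⋆ (g ⋆ h)) n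
⋆-assoc zero f g h = solve 3 (λ a b c → ((a :* b :+ con 0ℚ) :* c) :+ con 0ℚ
     := a :* (b :* c :+ con 0ℚ) :+ con 0ℚ) refl (f 0) (g 0) (h 0)
⋆-assoc (suc n) f g h = begin
    (f ⋆ g) 0 * h (suc n) + (tail (f ⋆ g) ⋆ h) n
  ≡⟨ cong ((f ⋆ g) 0 * h (suc n) +_) (trans
        (⋆-distribʳ-+ (λ i → f 0 * g (suc i)) (tail f ⋆ g) h n)
        (cong₂ _+_ (⋆-scaleˡ (f 0) (tail g) h n) (⋆-assoc n (tail f) g h))) ⟩
    (f ⋆ g) 0 * h (suc n) + (f 0 * (tail g ⋆ h) n + (tail f ⋆ (g ⋆ h)) n)
  ≡⟨ solve 5 (λ a b c d e → ((a :* b :+ con 0ℚ) :* c) :+ (a :* d :+ e)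
       := a :* (b :* c :+ d) :+ e) refl (f 0) (g 0) (h (suc n)) ((tail g ⋆ h) n) _ ⟩
    f 0 * (g ⋆ h) (suc n) + (tail f ⋆ (g ⋆ h)) n ∎
  where open ≡-Reasoning

shift-⋆ : ∀ f g n → (shift f ⋆ g) (suc n) ≡ (f ⋆ g) n
shift-⋆ f g n = trans (cong (_+ (f ⋆ g) n) (ℚP.*-zeroˡ (g (suc n)))) (ℚP.+-identityˡ _)

⋆-shift : ∀ n f g → (f ⋆ shift g) n ≡ shift (f ⋆ g) n
⋆-shift zero f g = trans (ℚP.+-identityʳ _) (ℚP.*-zeroʳ (f 0))
⋆-shift (suc zero) f g = cong (f 0 * g 0 +_) (⋆-shift zero (tail f) g)
⋆-shift (suc (suc n)) f g = cong (f 0 * g (suc n) +_) (⋆-shift (suc n) (tail f) g)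

⋆-δ : ∀ n f → (f ⋆ δ) n ≡ f n
⋆-δ zero f = trans (ℚP.+-identityʳ _) (ℚP.*-identityʳ (f 0))
⋆-δ (suc n) f = trans (cong (_+ (tail f ⋆ δ) n) (ℚP.*-zeroʳ (f 0)))
  (trans (ℚP.+-identityˡ _) (⋆-δ n (tail f)))

twist-⋆ : ∀ n f g → (twist f ⋆ twist g) n ≡ twist (f ⋆ g) n
twist-⋆ zero f g = solve 2 (λ a b → (con 1ℚ :* a) :* (con 1ℚ :* b) :+ con 0ℚ
   := con 1ℚ :* (a :* b :+ con 0ℚ)) refl (f 0) (g 0)
twist-⋆ (suc n) f g = begin
    twist f 0 * twist g (suc n) + (tail (twist f) ⋆ twist g) n
  ≡⟨ cong (twist f 0 * twist g (suc n) +_) (trans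
       (⋆-congˡ (twist g) (λ i → solve 2 (λ s x → (:- s) :* x := (:- con 1ℚ) :* (s :* x))
                                         refl (sgn i) (f (suc i))) n)
       (trans (⋆-scaleˡ (- 1ℚ) (twist (tail f)) (twist g) n)
              (cong (- 1ℚ *_) (twist-⋆ n (tail f) g)))) ⟩
    twist f 0 * twist g (suc n) + (- 1ℚ) * twist (tail f ⋆ g) n
  ≡⟨ solve 4 (λ a b s c → (con 1ℚ :* a) :* ((:- s) :* b) :+ (:- con 1ℚ) :* (s :* c)
       := (:- s) :* (a :* b :+ c)) refl (f 0) (g (suc n)) (sgn n) ((tail f ⋆ g) n) ⟩
    twist (f ⋆ g) (suc n) ∎
  where open ≡-Reasoning

⋆-cancel : ∀ T D → T 0 ≢ 0ℚ → (∀ n → (T ⋆ D) n ≡ 0ℚ) → ∀ n → D n ≡ 0ℚ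
⋆-cancel T D T0≢0 T⋆D≡0 = <-rec (λ n → D n ≡ 0ℚ) step
  where
  step : ∀ n → (∀ {m} → m < n → D m ≡ 0ℚ) → D n ≡ 0ℚ
  step n D<n≡0 = *-cancel-≡0 (T 0) (D n) T0≢0 (begin
      T 0 * D n                                            ≡⟨ sym (ℚP.+-identityʳ _) ⟩
      T 0 * D n + 0ℚ                                       ≡⟨ cong (T 0 * D n +_) (sym (Σ<-0 n)) ⟩
      T 0 * D n + Σ< n (λ _ → 0ℚ)                          ≡⟨ cong (T 0 * D n +_) (sym (Σ<-cong n higher)) ⟩
      T 0 * D n + Σ< n (λ j → T (suc j) * D (n ℕ.∸ suc j)) ≡⟨ T⋆D≡0 n ⟩
      0ℚ ∎)
    where
    open ≡-Reasoning
    higher : ∀ j → j < n → T (suc j) * D (n ℕ.∸ suc j) ≡ 0ℚ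
    higher j j<n = trans (cong (T (suc j) *_) (D<n≡0 (ℕP.∸-monoʳ-< (s≤s z≤n) j<n)))
                         (ℚP.*-zeroʳ (T (suc j)))

exp : ℚ → Seq
exp c n = c ^ℕ n * inv (ℕ→ℚ (n !))

exp-0ᶜ : ∀ c → exp c 0 ≡ 1ℚ
exp-0ᶜ c = cong (1ℚ *_) inv-1

exp-0 : ∀ n → exp 0ℚ n ≡ δ n
exp-0 zero = exp-0ᶜ 0ℚ
exp-0 (suc n) = trans (ℚP.*-assoc 0ℚ (0ℚ ^ℕ n) (inv (ℕ→ℚ (suc n !)))) (ℚP.*-zeroˡ ((0ℚ ^ℕ n) * inv (ℕ→ℚ (suc n !))))

twist-exp : ∀ c n → twist (exp c) n ≡ exp (- c) n
twist-exp c n = trans (sym (ℚP.*-assoc (sgn n) (c ^ℕ n) _))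
  (cong (_* inv (ℕ→ℚ (n !))) (sym (^ℕ-neg c n)))

binomial/n! : ∀ n k → k ≤ n →
  ℕ→ℚ (n C k) * inv (ℕ→ℚ (n !)) ≡ inv (ℕ→ℚ (k !)) * inv (ℕ→ℚ ((n ℕ.∸ k) !))
binomial/n! n k k≤n = begin
    ℕ→ℚ (n C k) * inv (ℕ→ℚ (n !))
  ≡⟨ sym (inv-unique (ℕ→ℚ (k !) * ℕ→ℚ ((n ℕ.∸ k) !)) _ inverse) ⟩
    inv (ℕ→ℚ (k !) * ℕ→ℚ ((n ℕ.∸ k) !))
  ≡⟨ inv-* (ℕ→ℚ (k !)) (ℕ→ℚ ((n ℕ.∸ k) !)) (n!≢0 k) (n!≢0 (n ℕ.∸ k)) ⟩
    inv (ℕ→ℚ (k !)) * inv (ℕ→ℚ ((n ℕ.∸ k) !)) ∎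
  where
  open ≡-Reasoning
  nCk·k!·[n-k]! : (n C k) ℕ.* (k ! ℕ.* (n ℕ.∸ k) !) ≡ n !
  nCk·k!·[n-k]! = trans (cong (ℕ._* (k ! ℕ.* (n ℕ.∸ k) !)) (nCk≡n!/k![n-k]! k≤n))
    (m/n*n≡m {{k ℕP.!* (n ℕ.∸ k) !≢0}} (k![n∸k]!∣n! k≤n))
  inverse : (ℕ→ℚ (k !) * ℕ→ℚ ((n ℕ.∸ k) !)) * (ℕ→ℚ (n C k) * inv (ℕ→ℚ (n !))) ≡ 1ℚ
  inverse = begin
      (ℕ→ℚ (k !) * ℕ→ℚ ((n ℕ.∸ k) !)) * (ℕ→ℚ (n C k) * inv (ℕ→ℚ (n !)))
    ≡⟨ solve 4 (λ a b c i → (a :* b) :* (c :* i) := (c :* (a :* b)) :* i) refl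
               (ℕ→ℚ (k !)) (ℕ→ℚ ((n ℕ.∸ k) !)) (ℕ→ℚ (n C k)) (inv (ℕ→ℚ (n !))) ⟩
      (ℕ→ℚ (n C k) * (ℕ→ℚ (k !) * ℕ→ℚ ((n ℕ.∸ k) !))) * inv (ℕ→ℚ (n !))
    ≡⟨ cong (λ z → (ℕ→ℚ (n C k) * z) * inv (ℕ→ℚ (n !))) (ℕ→ℚ-* (k !) ((n ℕ.∸ k) !)) ⟩
      (ℕ→ℚ (n C k) * ℕ→ℚ (k ! ℕ.* (n ℕ.∸ k) !)) * inv (ℕ→ℚ (n !))
    ≡⟨ cong (_* inv (ℕ→ℚ (n !))) (trans (ℕ→ℚ-* (n C k) _) (cong ℕ→ℚ nCk·k!·[n-k]!)) ⟩
      ℕ→ℚ (n !) * inv (ℕ→ℚ (n !))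
    ≡⟨ inv-inverseʳ _ (n!≢0 n) ⟩
      1ℚ ∎

binomial-theorem : ∀ c d n →
  (c + d) ^ℕ n ≡ Σ< (suc n) (λ k → ℕ→ℚ (n C k) * (c ^ℕ k * d ^ℕ (n ℕ.∸ k)))
binomial-theorem c d n = begin
    (c + d) ^ℕ n
  ≡⟨ sym (pow≡^ℕ (c + d) n) ⟩
    n ×ᵐ (c + d)
  ≡⟨ theorem (ℚP.*-comm c d) n ⟩
    binomialExpansion n
  ≡⟨ sum≡Σ< (suc n) (λ k → (n C k) × (k ×ᵐ c * (n ℕ.∸ k) ×ᵐ d)) ⟩
    Σ< (suc n) (λ k → (n C k) × (k ×ᵐ c * (n ℕ.∸ k) ×ᵐ d))
  ≡⟨ Σ<-cong (suc n) (λ k _ → trans (×≡ℕ→ℚ* (n C k) _)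
       (cong (ℕ→ℚ (n C k) *_) (cong₂ _*_ (pow≡^ℕ c k) (pow≡^ℕ d (n ℕ.∸ k))))) ⟩
    Σ< (suc n) (λ k → ℕ→ℚ (n C k) * (c ^ℕ k * d ^ℕ (n ℕ.∸ k))) ∎
  where
  open ≡-Reasoning
  open Algebra.Definitions.RawMonoid ℚP.+-rawMonoid using (_×_; sum)
  open Algebra.Definitions.RawMonoid ℚP.*-rawMonoid using () renaming (_×_ to _×ᵐ_)
  open Binomial (CommutativeRing.semiring ℚP.+-*-commutativeRing) c d
    using (theorem; binomialExpansion)
  pow≡^ℕ : ∀ x n → n ×ᵐ x ≡ x ^ℕ n
  pow≡^ℕ x zero = refl
  pow≡^ℕ x (suc n) = cong (x *_) (pow≡^ℕ x n)
  ×≡ℕ→ℚ* : ∀ m x → m × x ≡ ℕ→ℚ m * x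
  ×≡ℕ→ℚ* zero x = sym (ℚP.*-zeroˡ x)
  ×≡ℕ→ℚ* (suc m) x = begin
      x + m × x          ≡⟨ cong (x +_) (×≡ℕ→ℚ* m x) ⟩
      x + ℕ→ℚ m * x      ≡⟨ solve 2 (λ x a → x :+ a :* x := (con 1ℚ :+ a) :* x) refl x (ℕ→ℚ m) ⟩
      (1ℚ + ℕ→ℚ m) * x   ≡⟨ cong (_* x) (ℕ→ℚ-+ 1 m) ⟩
      ℕ→ℚ (suc m) * x ∎
  sum≡Σ< : ∀ m (f : ℕ → ℚ) → sum {m} (λ i → f (toℕ i)) ≡ Σ< m f
  sum≡Σ< zero f = refl
  sum≡Σ< (suc m) f = cong (f 0 +_) (sum≡Σ< m (λ i → f (suc i)))

exp-⋆ : ∀ c d n → (exp c ⋆ exp d) n ≡ exp (c + d) n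
exp-⋆ c d n = sym (begin
    (c + d) ^ℕ n * inv (ℕ→ℚ (n !))
  ≡⟨ cong (_* inv (ℕ→ℚ (n !))) (binomial-theorem c d n) ⟩
    Σ< (suc n) (λ k → ℕ→ℚ (n C k) * (c ^ℕ k * d ^ℕ (n ℕ.∸ k))) * inv (ℕ→ℚ (n !))
  ≡⟨ ℚP.*-comm _ (inv (ℕ→ℚ (n !))) ⟩
    inv (ℕ→ℚ (n !)) * Σ< (suc n) (λ k → ℕ→ℚ (n C k) * (c ^ℕ k * d ^ℕ (n ℕ.∸ k)))
  ≡⟨ sym (Σ<-*ˡ (suc n) (inv (ℕ→ℚ (n !))) (λ k → ℕ→ℚ (n C k) * (c ^ℕ k * d ^ℕ (n ℕ.∸ k)))) ⟩
    Σ< (suc n) (λ k → inv (ℕ→ℚ (n !)) * (ℕ→ℚ (n C k) * (c ^ℕ k * d ^ℕ (n ℕ.∸ k))))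
  ≡⟨ Σ<-cong (suc n) (λ k k≤n → term k (ℕP.≤-pred k≤n)) ⟩
    (exp c ⋆ exp d) n ∎)
  where
  open ≡-Reasoning
  term : ∀ k → k ≤ n →
    inv (ℕ→ℚ (n !)) * (ℕ→ℚ (n C k) * (c ^ℕ k * d ^ℕ (n ℕ.∸ k))) ≡ exp c k * exp d (n ℕ.∸ k)
  term k k≤n = begin
      inv (ℕ→ℚ (n !)) * (ℕ→ℚ (n C k) * (c ^ℕ k * d ^ℕ (n ℕ.∸ k)))
    ≡⟨ solve 4 (λ i a x y → i :* (a :* (x :* y)) := (a :* i) :* (x :* y)) refl
               (inv (ℕ→ℚ (n !))) (ℕ→ℚ (n C k)) (c ^ℕ k) (d ^ℕ (n ℕ.∸ k)) ⟩
      (ℕ→ℚ (n C k) * inv (ℕ→ℚ (n !))) * (c ^ℕ k * d ^ℕ (n ℕ.∸ k))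
    ≡⟨ cong (_* (c ^ℕ k * d ^ℕ (n ℕ.∸ k))) (binomial/n! n k k≤n) ⟩
      (inv (ℕ→ℚ (k !)) * inv (ℕ→ℚ ((n ℕ.∸ k) !))) * (c ^ℕ k * d ^ℕ (n ℕ.∸ k))
    ≡⟨ solve 4 (λ a b x y → (a :* b) :* (x :* y) := (x :* a) :* (y :* b)) refl
               (inv (ℕ→ℚ (k !))) (inv (ℕ→ℚ ((n ℕ.∸ k) !))) (c ^ℕ k) (d ^ℕ (n ℕ.∸ k)) ⟩
      exp c k * exp d (n ℕ.∸ k) ∎

-- Parity of generalized Bernoulli numbers:  (-1)ⁿ B_{n,χ} = χ(-1) B_{n,χ}  for n ≠ 1.

module Parity (L : ℕ) .{{_ : NonZero L}} (χ : ℤ → ℚ) (isχ : IsDirichletCharacter L χ)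
              (B : ℕ → ℚ) (isB : IsGenBernoulli L χ B) where
  open IsDirichletCharacter isχ

  ℓ χ₋₁ χ₀ : ℚ
  ℓ = ℕ→ℚ L
  χ₋₁ = χ -[1+ 0 ]
  χ₀ = χ (pos 0)

  -- F = Σ B_{n,χ} xⁿ/n!,  A = e^{Lx} - 1,  T = A/x,  N = Σ_{a=1}^{L} χ(a) e^{ax}.
  F T A N : Seq
  F n = B n * inv (ℕ→ℚ (n !))
  T n = exp ℓ (suc n)
  A = shift T
  N n = Σ< L (λ i → χ (pos (suc i)) * exp (ℕ→ℚ (suc i)) n)

  -- The definition of B_{n,χ} says  T ⋆ F = N.
  generating-identity : ∀ n → (T ⋆ F) n ≡ N n
  generating-identity n = begin
      (T ⋆ F) n
    ≡⟨ Σ<-cong (suc n) (λ j _ → cong (λ z → (z * inv (ℕ→ℚ (suc j !))) * F (n ℕ.∸ j))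
                                     (sym (ℕ→ℚ-^ L (suc j)))) ⟩
      Σ< (suc n) (λ i → lhs (suc i))
    ≡⟨ sym (Σ₁≡Σ< (suc n) lhs) ⟩
      Σ₁ (suc n) lhs
    ≡⟨ isB n ⟩
      Σ₁ L rhs
    ≡⟨ Σ₁≡Σ< L rhs ⟩
      Σ< L (λ i → rhs (suc i))
    ≡⟨ Σ<-cong L (λ i _ → trans (ℚP.*-assoc (χ (pos (suc i))) (ℕ→ℚ (suc i ℕ.^ n)) (inv (ℕ→ℚ (n !))))
          (cong (λ z → χ (pos (suc i)) * (z * inv (ℕ→ℚ (n !)))) (ℕ→ℚ-^ (suc i) n))) ⟩
      N n ∎
    where
    open ≡-Reasoning
    lhs rhs : ℕ → ℚ
    lhs j = (ℕ→ℚ (L ℕ.^ j) * inv (ℕ→ℚ (j !))) * (B (suc n ℕ.∸ j) * inv (ℕ→ℚ ((suc n ℕ.∸ j) !)))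
    rhs b = χ (pos b) * ℕ→ℚ (b ℕ.^ n) * inv (ℕ→ℚ (n !))

  δ-exp≡-A : ∀ n → δ n - exp ℓ n ≡ - 1ℚ * A n
  δ-exp≡-A zero = cong (λ z → 1ℚ - z) (exp-0ᶜ ℓ)
  δ-exp≡-A (suc n) = solve 1 (λ x → con 0ℚ :- x := (:- con 1ℚ) :* x) refl (T n)

  -- e^{Lx} · A(-x) = e^{Lx} (e^{-Lx} - 1) = -A.
  exp⋆twist-A : ∀ n → (exp ℓ ⋆ twist A) n ≡ - 1ℚ * A n
  exp⋆twist-A n = begin
      (exp ℓ ⋆ twist A) n
    ≡⟨ ⋆-congʳ (exp ℓ) twist-A n ⟩
      (exp ℓ ⋆ (λ i → exp (- ℓ) i + - 1ℚ * δ i)) n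
    ≡⟨ ⋆-distribˡ-+ (exp ℓ) (exp (- ℓ)) (λ i → - 1ℚ * δ i) n ⟩
      (exp ℓ ⋆ exp (- ℓ)) n + (exp ℓ ⋆ (λ i → - 1ℚ * δ i)) n
    ≡⟨ cong₂ _+_ (exp-⋆ ℓ (- ℓ) n) (⋆-scaleʳ (- 1ℚ) (exp ℓ) δ n) ⟩
      exp (ℓ + - ℓ) n + - 1ℚ * (exp ℓ ⋆ δ) n
    ≡⟨ cong₂ _+_ (trans (cong (λ c → exp c n) (ℚP.+-inverseʳ ℓ)) (exp-0 n))
                 (cong (- 1ℚ *_) (⋆-δ n (exp ℓ))) ⟩
      δ n + - 1ℚ * exp ℓ n
    ≡⟨ solve 2 (λ d e → d :+ (:- con 1ℚ) :* e := d :- e) refl (δ n) (exp ℓ n) ⟩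
      δ n - exp ℓ n
    ≡⟨ δ-exp≡-A n ⟩
      - 1ℚ * A n ∎
    where
    open ≡-Reasoning
    twist-A : ∀ i → twist A i ≡ exp (- ℓ) i + - 1ℚ * δ i
    twist-A zero = sym (cong (_+ (- 1ℚ * 1ℚ)) (exp-0ᶜ (- ℓ)))
    twist-A (suc i) = trans (twist-exp ℓ (suc i)) (sym (ℚP.+-identityʳ (exp (- ℓ) (suc i))))

  -- Substituting -x in A ⋆ F = x N and multiplying by e^{Lx} gives  T ⋆ F(-x) = e^{Lx} N(-x).
  T⋆twist-F : ∀ n → (T ⋆ twist F) n ≡ (exp ℓ ⋆ twist N) n
  T⋆twist-F n = -1*-injective (begin
      - 1ℚ * (T ⋆ twist F) n
    ≡⟨ cong (- 1ℚ *_) (sym (shift-⋆ T (twist F) n)) ⟩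
      - 1ℚ * (A ⋆ twist F) (suc n)
    ≡⟨ sym (⋆-scaleˡ (- 1ℚ) A (twist F) (suc n)) ⟩
      ((λ i → - 1ℚ * A i) ⋆ twist F) (suc n)
    ≡⟨ sym (⋆-congˡ (twist F) exp⋆twist-A (suc n)) ⟩
      ((exp ℓ ⋆ twist A) ⋆ twist F) (suc n)
    ≡⟨ ⋆-assoc (suc n) (exp ℓ) (twist A) (twist F) ⟩
      (exp ℓ ⋆ (twist A ⋆ twist F)) (suc n)
    ≡⟨ ⋆-congʳ (exp ℓ) twisted-identity (suc n) ⟩
      (exp ℓ ⋆ (λ i → - 1ℚ * shift (twist N) i)) (suc n)
    ≡⟨ ⋆-scaleʳ (- 1ℚ) (exp ℓ) (shift (twist N)) (suc n) ⟩
      - 1ℚ * (exp ℓ ⋆ shift (twist N)) (suc n)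
    ≡⟨ cong (- 1ℚ *_) (⋆-shift (suc n) (exp ℓ) (twist N)) ⟩
      - 1ℚ * (exp ℓ ⋆ twist N) n ∎)
    where
    open ≡-Reasoning
    A⋆F : ∀ i → (A ⋆ F) i ≡ shift N i
    A⋆F zero = trans (ℚP.+-identityʳ (0ℚ * F 0)) (ℚP.*-zeroˡ (F 0))
    A⋆F (suc i) = trans (shift-⋆ T F i) (generating-identity i)
    twisted-identity : ∀ i → (twist A ⋆ twist F) i ≡ - 1ℚ * shift (twist N) i
    twisted-identity zero = trans (twist-⋆ zero A F) (cong (1ℚ *_) (A⋆F zero))
    twisted-identity (suc i) = begin
        (twist A ⋆ twist F) (suc i)  ≡⟨ twist-⋆ (suc i) A F ⟩
        - sgn i * (A ⋆ F) (suc i)    ≡⟨ cong (- sgn i *_) (A⋆F (suc i)) ⟩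
        - sgn i * N i                ≡⟨ solve 2 (λ s x → (:- s) :* x := (:- con 1ℚ) :* (s :* x)) refl (sgn i) (N i) ⟩
        - 1ℚ * (sgn i * N i) ∎
    -1*-injective : ∀ {x y} → - 1ℚ * x ≡ - 1ℚ * y → x ≡ y
    -1*-injective {x} {y} eq =
      trans (solve 1 (λ x → x := (:- con 1ℚ) :* ((:- con 1ℚ) :* x)) refl x)
        (trans (cong (- 1ℚ *_) eq) (solve 1 (λ x → (:- con 1ℚ) :* ((:- con 1ℚ) :* x) := x) refl y))

  χ-reflect : ∀ i → i < L → χ (pos (suc i)) ≡ χ₋₁ * χ (pos (L ℕ.∸ suc i))
  χ-reflect i i<L = sym (begin
      χ₋₁ * χ (pos b)                ≡⟨ sym (multiplicative -[1+ 0 ] (pos b)) ⟩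
      χ (-[1+ 0 ] ℤ.* pos b)         ≡⟨ cong χ (ℤP.-1*i≡-i (pos b)) ⟩
      χ (ℤ.- pos b)                  ≡⟨ sym (periodic (ℤ.- pos b)) ⟩
      χ (ℤ.- pos b ℤ.+ pos L)        ≡⟨ cong χ -b+L≡a ⟩
      χ (pos (suc i)) ∎)
    where
    open ≡-Reasoning
    b = L ℕ.∸ suc i
    -b+L≡a : ℤ.- pos b ℤ.+ pos L ≡ pos (suc i)
    -b+L≡a = begin
        ℤ.- pos b ℤ.+ pos L                  ≡⟨ cong (λ z → ℤ.- pos b ℤ.+ pos z) (sym (ℕP.m∸n+n≡m i<L)) ⟩
        ℤ.- pos b ℤ.+ pos (b ℕ.+ suc i)      ≡⟨ cong (λ z → ℤ.- pos b ℤ.+ z) (ℤP.pos-+ b (suc i)) ⟩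
        ℤ.- pos b ℤ.+ (pos b ℤ.+ pos (suc i)) ≡⟨ sym (ℤP.+-assoc (ℤ.- pos b) (pos b) (pos (suc i))) ⟩
        (ℤ.- pos b ℤ.+ pos b) ℤ.+ pos (suc i) ≡⟨ cong (ℤ._+ pos (suc i)) (ℤP.+-inverseˡ (pos b)) ⟩
        pos (suc i) ∎

  -- Σ_{b=0}^{L-1} χ(b) e^{bx}, the image of N under a ↦ L - a.
  N′ : Seq
  N′ n = Σ< L (λ b → χ (pos b) * exp (ℕ→ℚ b) n)

  -- e^{Lx} N(-x) = Σ_{a=1}^{L} χ(a) e^{(L-a)x} = χ(-1) N′.
  exp⋆twist-N : ∀ n → (exp ℓ ⋆ twist N) n ≡ χ₋₁ * N′ n
  exp⋆twist-N n = begin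
      (exp ℓ ⋆ twist N) n
    ≡⟨ ⋆-congʳ (exp ℓ) twist-N n ⟩
      (exp ℓ ⋆ (λ k → Σ< L (λ i → χ (pos (suc i)) * exp (- a i) k))) n
    ≡⟨ ⋆-Σ<ʳ (exp ℓ) L (λ i k → χ (pos (suc i)) * exp (- a i) k) n ⟩
      Σ< L (λ i → (exp ℓ ⋆ (λ k → χ (pos (suc i)) * exp (- a i) k)) n)
    ≡⟨ Σ<-cong L (λ i _ → trans (⋆-scaleʳ (χ (pos (suc i))) (exp ℓ) (exp (- a i)) n)
                                (cong (χ (pos (suc i)) *_) (exp-⋆ ℓ (- a i) n))) ⟩
      Σ< L (λ i → χ (pos (suc i)) * exp (ℓ + - a i) n)
    ≡⟨ Σ<-cong L (λ i i<L → trans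
         (cong₂ _*_ (χ-reflect i i<L) (cong (λ c → exp c n) (sym (ℕ→ℚ-∸ L (suc i) i<L))))
         (ℚP.*-assoc χ₋₁ (χ (pos (L ℕ.∸ suc i))) (exp (ℕ→ℚ (L ℕ.∸ suc i)) n))) ⟩
      Σ< L (λ i → χ₋₁ * term (L ℕ.∸ suc i))
    ≡⟨ Σ<-*ˡ L χ₋₁ (λ i → term (L ℕ.∸ suc i)) ⟩
      χ₋₁ * Σ< L (λ i → term (L ℕ.∸ suc i))
    ≡⟨ cong (χ₋₁ *_) (sym (Σ<-reverse L term)) ⟩
      χ₋₁ * N′ n ∎
    where
    open ≡-Reasoning
    a : ℕ → ℚ
    a i = ℕ→ℚ (suc i)
    term : ℕ → ℚ
    term b = χ (pos b) * exp (ℕ→ℚ b) n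
    twist-N : ∀ k → twist N k ≡ Σ< L (λ i → χ (pos (suc i)) * exp (- a i) k)
    twist-N k = trans (sym (Σ<-*ˡ L (sgn k) (λ i → χ (pos (suc i)) * exp (a i) k)))
      (Σ<-cong L (λ i _ → trans
         (solve 3 (λ s c e → s :* (c :* e) := c :* (s :* e)) refl (sgn k) (χ (pos (suc i))) (exp (a i) k))
         (cong (χ (pos (suc i)) *_) (twist-exp (a i) k))))

  -- N′ = N + χ(0)(1 - e^{Lx}), since χ(L) = χ(0).
  N′≡N-χ₀A : ∀ n → N′ n ≡ N n + χ₀ * (- 1ℚ * A n)
  N′≡N-χ₀A n = begin
      N′ n
    ≡⟨ solve 2 (λ x y → x := (x :+ y) :+ (:- y)) refl (N′ n) (χ₀ * exp ℓ n) ⟩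
      (N′ n + χ₀ * exp ℓ n) + - (χ₀ * exp ℓ n)
    ≡⟨ cong (_+ - (χ₀ * exp ℓ n)) full-range ⟩
      (χ₀ * δ n + N n) + - (χ₀ * exp ℓ n)
    ≡⟨ solve 4 (λ c d y e → (c :* d :+ y) :+ (:- (c :* e)) := y :+ c :* (d :- e)) refl χ₀ (δ n) (N n) (exp ℓ n) ⟩
      N n + χ₀ * (δ n - exp ℓ n)
    ≡⟨ cong (λ z → N n + χ₀ * z) (δ-exp≡-A n) ⟩
      N n + χ₀ * (- 1ℚ * A n) ∎
    where
    open ≡-Reasoning
    -- both sides are Σ_{b=0}^{L} χ(b) e^{bx}
    full-range : N′ n + χ₀ * exp ℓ n ≡ χ₀ * δ n + N n
    full-range = trans (cong (λ z → N′ n + z * exp ℓ n) (sym (periodic (pos 0))))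
      (trans (sym (Σ<-last L (λ b → χ (pos b) * exp (ℕ→ℚ b) n)))
             (cong (λ z → χ₀ * z + N n) (exp-0 n)))

  D : Seq
  D n = twist F n + ((- χ₋₁) * F n + (χ₋₁ * χ₀) * shift δ n)

  T⋆D≡0 : ∀ n → (T ⋆ D) n ≡ 0ℚ
  T⋆D≡0 n = begin
      (T ⋆ D) n
    ≡⟨ ⋆-distribˡ-+ T (twist F) (λ i → (- χ₋₁) * F i + (χ₋₁ * χ₀) * shift δ i) n ⟩
      (T ⋆ twist F) n + (T ⋆ (λ i → (- χ₋₁) * F i + (χ₋₁ * χ₀) * shift δ i)) n
    ≡⟨ cong ((T ⋆ twist F) n +_) (trans
         (⋆-distribˡ-+ T (λ i → (- χ₋₁) * F i) (λ i → (χ₋₁ * χ₀) * shift δ i) n)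
         (cong₂ _+_ (⋆-scaleʳ (- χ₋₁) T F n) (⋆-scaleʳ (χ₋₁ * χ₀) T (shift δ) n))) ⟩
      (T ⋆ twist F) n + ((- χ₋₁) * (T ⋆ F) n + (χ₋₁ * χ₀) * (T ⋆ shift δ) n)
    ≡⟨ cong₂ _+_ (trans (T⋆twist-F n) (trans (exp⋆twist-N n) (cong (χ₋₁ *_) (N′≡N-χ₀A n))))
                 (cong₂ (λ p q → (- χ₋₁) * p + (χ₋₁ * χ₀) * q) (generating-identity n) (T⋆x≡A n)) ⟩
      χ₋₁ * (N n + χ₀ * (- 1ℚ * A n)) + ((- χ₋₁) * N n + (χ₋₁ * χ₀) * A n)
    ≡⟨ solve 4 (λ m z y w → m :* (y :+ z :* ((:- con 1ℚ) :* w)) :+ ((:- m) :* y :+ (m :* z) :* w) := con 0ℚ)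
         refl χ₋₁ χ₀ (N n) (A n) ⟩
      0ℚ ∎
    where
    open ≡-Reasoning
    T⋆x≡A : ∀ n → (T ⋆ shift δ) n ≡ A n
    T⋆x≡A zero = ⋆-shift zero T δ
    T⋆x≡A (suc m) = trans (⋆-shift (suc m) T δ) (⋆-δ m T)

  -- The constant term of T is L ≠ 0, so D = 0; off n = 1 this is parity.
  parity : ∀ n → n ≢ 1 → sgn n * F n ≡ χ₋₁ * F n
  parity n n≢1 = begin
      sgn n * F n
    ≡⟨ solve 4 (λ q m p c → q := (q :+ ((:- m) :* p :+ c :* con 0ℚ)) :+ m :* p) refl
               (twist F n) χ₋₁ (F n) (χ₋₁ * χ₀) ⟩
      (twist F n + ((- χ₋₁) * F n + (χ₋₁ * χ₀) * 0ℚ)) + χ₋₁ * F n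
    ≡⟨ cong (λ z → (twist F n + ((- χ₋₁) * F n + (χ₋₁ * χ₀) * z)) + χ₋₁ * F n) (sym (x-coeff n n≢1)) ⟩
      D n + χ₋₁ * F n
    ≡⟨ cong (_+ χ₋₁ * F n) (⋆-cancel T D T0≢0 T⋆D≡0 n) ⟩
      0ℚ + χ₋₁ * F n
    ≡⟨ ℚP.+-identityˡ _ ⟩
      χ₋₁ * F n ∎
    where
    open ≡-Reasoning
    T0≢0 : T 0 ≢ 0ℚ
    T0≢0 T0≡0 = ℕ→ℚ-≢0 L (trans (sym T0≡ℓ) T0≡0)
      where
      T0≡ℓ : T 0 ≡ ℓ
      T0≡ℓ = trans (cong ((ℓ * 1ℚ) *_) inv-1) (trans (ℚP.*-identityʳ _) (ℚP.*-identityʳ ℓ))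
    x-coeff : ∀ n → n ≢ 1 → shift δ n ≡ 0ℚ
    x-coeff zero _ = refl
    x-coeff (suc zero) 1≢1 = ⊥-elim (1≢1 refl)
    x-coeff (suc (suc m)) _ = refl

-- Laurent powers

^ℤ-⊖ : ∀ x → x * inv x ≡ 1ℚ → ∀ a b → x ^ℤ (a ⊖ b) ≡ x ^ℕ a * inv x ^ℕ b
^ℤ-⊖ x x·x⁻¹≡1 zero zero = refl
^ℤ-⊖ x x·x⁻¹≡1 (suc a) zero = sym (ℚP.*-identityʳ _)
^ℤ-⊖ x x·x⁻¹≡1 zero (suc b) = sym (ℚP.*-identityˡ _)
^ℤ-⊖ x x·x⁻¹≡1 (suc a) (suc b) = begin
    x ^ℤ (suc a ⊖ suc b)
  ≡⟨ cong (x ^ℤ_) (ℤP.[1+m]⊖[1+n]≡m⊖n a b) ⟩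
    x ^ℤ (a ⊖ b)
  ≡⟨ ^ℤ-⊖ x x·x⁻¹≡1 a b ⟩
    x ^ℕ a * inv x ^ℕ b
  ≡⟨ sym (ℚP.*-identityˡ _) ⟩
    1ℚ * (x ^ℕ a * inv x ^ℕ b)
  ≡⟨ cong (_* (x ^ℕ a * inv x ^ℕ b)) (sym x·x⁻¹≡1) ⟩
    (x * inv x) * (x ^ℕ a * inv x ^ℕ b)
  ≡⟨ solve 4 (λ x y p q → (x :* y) :* (p :* q) := (x :* p) :* (y :* q)) refl x (inv x) (x ^ℕ a) (inv x ^ℕ b) ⟩
    (x * x ^ℕ a) * (inv x * inv x ^ℕ b) ∎
  where open ≡-Reasoning

k-s-1≡k⊖[1+s] : ∀ k s → (pos k ℤ.- pos s) ℤ.- pos 1 ≡ k ⊖ suc s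
k-s-1≡k⊖[1+s] k s = begin
    (pos k ℤ.- pos s) ℤ.- pos 1       ≡⟨ ℤP.+-assoc (pos k) (ℤ.- pos s) (ℤ.- pos 1) ⟩
    pos k ℤ.+ (ℤ.- pos s ℤ.- pos 1)   ≡⟨ cong (λ z → pos k ℤ.+ z) (sym (ℤP.neg-distrib-+ (pos s) (pos 1))) ⟩
    pos k ℤ.- (pos s ℤ.+ pos 1)       ≡⟨ cong (λ z → pos k ℤ.- z) (trans (sym (ℤP.pos-+ s 1)) (cong pos (ℕP.+-comm s 1))) ⟩
    pos k ℤ.- pos (suc s)             ≡⟨ ℤP.m-n≡m⊖n k (suc s) ⟩
    k ⊖ suc s ∎
  where open ≡-Reasoning

-- Reflection of one summand

summand : (M k s : ℕ) → (c Z : ℚ) → ℚ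
summand M k s c Z =
  c * (((Z - 1ℚ) * inv (ℕ→ℚ M)) ^ℤ ((pos k ℤ.- pos s) ℤ.- pos 1)) * (1ℚ - Z ^ℤ (pos s ℤ.- pos 1))

summand-1≡0 : ∀ M k c Z → summand M k 1 c Z ≡ 0ℚ
summand-1≡0 M k c Z = ℚP.*-zeroʳ (c * (((Z - 1ℚ) * inv (ℕ→ℚ M)) ^ℤ ((pos k ℤ.- pos 1) ℤ.- pos 1)))

summand-scale : ∀ M k s a c Z → summand M k s (a * c) Z ≡ a * summand M k s c Z
summand-scale M k s a c Z = solve 4 (λ a c p q → (a :* c) :* p :* q := a :* (c :* p :* q)) refl
  a c (((Z - 1ℚ) * inv (ℕ→ℚ M)) ^ℤ ((pos k ℤ.- pos s) ℤ.- pos 1)) (1ℚ - Z ^ℤ (pos s ℤ.- pos 1))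

module Inversion (M : ℕ) .{{_ : NonZero M}} (X : ℚ) (X≢0 : X ≢ 0ℚ) (X≢1 : X ≢ 1ℚ) where
  -- u = 1/X, Y = (X-1)/M with inverse v, and Y′ = (u-1)/M = -Y u with inverse -v X.
  u Y v Y′ : ℚ
  u = inv X
  Y = (X - 1ℚ) * inv (ℕ→ℚ M)
  v = inv Y
  Y′ = (u - 1ℚ) * inv (ℕ→ℚ M)

  Xu≡1 : X * u ≡ 1ℚ
  Xu≡1 = inv-inverseʳ X X≢0

  inv-u : inv u ≡ X
  inv-u = inv-unique u X (inv-inverseˡ X X≢0)

  Yv≡1 : Y * v ≡ 1ℚ
  Yv≡1 = inv-inverseʳ Y (invertible⇒≢0 Y (ℕ→ℚ M * inv (X - 1ℚ)) (begin
      ((X - 1ℚ) * inv (ℕ→ℚ M)) * (ℕ→ℚ M * inv (X - 1ℚ))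
    ≡⟨ solve 4 (λ a i m j → (a :* i) :* (m :* j) := (a :* j) :* (m :* i)) refl
               (X - 1ℚ) (inv (ℕ→ℚ M)) (ℕ→ℚ M) (inv (X - 1ℚ)) ⟩
      ((X - 1ℚ) * inv (X - 1ℚ)) * (ℕ→ℚ M * inv (ℕ→ℚ M))
    ≡⟨ cong₂ _*_ (inv-inverseʳ (X - 1ℚ) X-1≢0) (inv-inverseʳ (ℕ→ℚ M) (ℕ→ℚ-≢0 M)) ⟩
      1ℚ ∎))
    where
    open ≡-Reasoning
    X-1≢0 : X - 1ℚ ≢ 0ℚ
    X-1≢0 X-1≡0 = X≢1 (trans (solve 1 (λ x → x := (x :- con 1ℚ) :+ con 1ℚ) refl X)
                              (cong (_+ 1ℚ) X-1≡0))

  Y′≡-Yu : Y′ ≡ - (Y * u)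
  Y′≡-Yu = begin
      (u - 1ℚ) * inv (ℕ→ℚ M)
    ≡⟨ solve 3 (λ u i x → (u :- con 1ℚ) :* i := (:- (((x :- con 1ℚ) :* i) :* u)) :+ (x :* u :- con 1ℚ) :* i)
               refl u (inv (ℕ→ℚ M)) X ⟩
      - (Y * u) + (X * u - 1ℚ) * inv (ℕ→ℚ M)
    ≡⟨ cong (λ q → - (Y * u) + (q - 1ℚ) * inv (ℕ→ℚ M)) Xu≡1 ⟩
      - (Y * u) + (1ℚ - 1ℚ) * inv (ℕ→ℚ M)
    ≡⟨ solve 2 (λ a i → a :+ (con 1ℚ :- con 1ℚ) :* i := a) refl (- (Y * u)) (inv (ℕ→ℚ M)) ⟩
      - (Y * u) ∎
    where open ≡-Reasoning

  Y′-inverse : Y′ * - (v * X) ≡ 1ℚ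
  Y′-inverse = begin
      Y′ * - (v * X)           ≡⟨ cong (_* - (v * X)) Y′≡-Yu ⟩
      - (Y * u) * - (v * X)    ≡⟨ solve 4 (λ y u v x → (:- (y :* u)) :* (:- (v :* x)) := (y :* v) :* (x :* u)) refl Y u v X ⟩
      (Y * v) * (X * u)        ≡⟨ cong₂ _*_ Yv≡1 Xu≡1 ⟩
      1ℚ ∎
    where open ≡-Reasoning

  inv-Y′ : inv Y′ ≡ - (v * X)
  inv-Y′ = inv-unique Y′ (- (v * X)) Y′-inverse

  Y-power : ∀ k s → Y ^ℤ ((pos k ℤ.- pos s) ℤ.- pos 1) ≡ Y ^ℕ k * v ^ℕ suc s
  Y-power k s = trans (cong (Y ^ℤ_) (k-s-1≡k⊖[1+s] k s)) (^ℤ-⊖ Y Yv≡1 k (suc s))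

  Y′-power : ∀ k s → Y′ ^ℤ ((pos k ℤ.- pos s) ℤ.- pos 1)
                     ≡ (sgn k * (Y ^ℕ k * u ^ℕ k)) * (sgn (suc s) * (v ^ℕ suc s * X ^ℕ suc s))
  Y′-power k s = begin
      Y′ ^ℤ ((pos k ℤ.- pos s) ℤ.- pos 1)
    ≡⟨ cong (Y′ ^ℤ_) (k-s-1≡k⊖[1+s] k s) ⟩
      Y′ ^ℤ (k ⊖ suc s)
    ≡⟨ ^ℤ-⊖ Y′ (trans (cong (Y′ *_) inv-Y′) Y′-inverse) k (suc s) ⟩
      Y′ ^ℕ k * inv Y′ ^ℕ suc s
    ≡⟨ cong₂ _*_ (trans (cong (_^ℕ k) Y′≡-Yu) (trans (^ℕ-neg (Y * u) k) (cong (sgn k *_) (^ℕ-* Y u k))))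
                 (trans (cong (_^ℕ suc s) inv-Y′)
                        (trans (^ℕ-neg (v * X) (suc s)) (cong (sgn (suc s) *_) (^ℕ-* v X (suc s))))) ⟩
      (sgn k * (Y ^ℕ k * u ^ℕ k)) * (sgn (suc s) * (v ^ℕ suc s * X ^ℕ suc s)) ∎
    where open ≡-Reasoning

  X-power : ∀ s → X ^ℤ (pos s ℤ.- pos 1) ≡ X ^ℕ s * (u * 1ℚ)
  X-power s = trans (cong (X ^ℤ_) (ℤP.m-n≡m⊖n s 1)) (^ℤ-⊖ X Xu≡1 s 1)

  u-power : ∀ s → u ^ℤ (pos s ℤ.- pos 1) ≡ u ^ℕ s * (X * 1ℚ)
  u-power s = trans (cong (u ^ℤ_) (ℤP.m-n≡m⊖n s 1))
    (trans (^ℤ-⊖ u (trans (cong (u *_) inv-u) (inv-inverseˡ X X≢0)) s 1)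
           (cong (λ z → u ^ℕ s * (z * 1ℚ)) inv-u))

  X-power-k-2 : ∀ k → X ^ℤ (pos k ℤ.- pos 2) ≡ X ^ℕ k * (u * (u * 1ℚ))
  X-power-k-2 k = trans (cong (X ^ℤ_) (ℤP.m-n≡m⊖n k 2)) (^ℤ-⊖ X Xu≡1 k 2)

  summand-inversion : ∀ k s c →
    X ^ℤ (pos k ℤ.- pos 2) * summand M k s c u ≡ summand M k s (sgn k * sgn s * c) X
  summand-inversion k s c = begin
      X ^ℤ (pos k ℤ.- pos 2) * summand M k s c u
    ≡⟨ cong₂ (λ p q → p * (c * q * (1ℚ - u ^ℤ (pos s ℤ.- pos 1)))) (X-power-k-2 k) (Y′-power k s) ⟩
      (Xk * (u * (u * 1ℚ))) * (c * ((sk * (Yk * uk)) * ((- ss) * ((v * vs) * (X * Xs)))) * (1ℚ - u ^ℤ (pos s ℤ.- pos 1)))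
    ≡⟨ cong (λ q → (Xk * (u * (u * 1ℚ))) * (c * ((sk * (Yk * uk)) * ((- ss) * ((v * vs) * (X * Xs)))) * (1ℚ - q))) (u-power s) ⟩
      (Xk * (u * (u * 1ℚ))) * (c * ((sk * (Yk * uk)) * ((- ss) * ((v * vs) * (X * Xs)))) * (1ℚ - us * (X * 1ℚ)))
    ≡⟨ solve 12 (λ c Yk vs Xk uk Xs us sk ss X u v →
          (Xk :* (u :* (u :* con 1ℚ))) :* (c :* ((sk :* (Yk :* uk)) :* ((:- ss) :* ((v :* vs) :* (X :* Xs)))) :* (con 1ℚ :- us :* (X :* con 1ℚ)))
          := (:- (sk :* ss :* c)) :* (Yk :* (v :* vs)) :* ((Xk :* uk) :* ((X :* u) :* (u :* Xs :- (Xs :* us) :* (X :* u)))))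
         refl c Yk vs Xk uk Xs us sk ss X u v ⟩
      - K * W * ((Xk * uk) * ((X * u) * (u * Xs - (Xs * us) * (X * u))))
    ≡⟨ cong₂ (λ a b → - K * W * (a * (b * (u * Xs - (Xs * us) * b)))) (^ℕ-inverse X u Xu≡1 k) Xu≡1 ⟩
      - K * W * (1ℚ * (1ℚ * (u * Xs - (Xs * us) * 1ℚ)))
    ≡⟨ cong (λ a → - K * W * (1ℚ * (1ℚ * (u * Xs - a * 1ℚ)))) (^ℕ-inverse X u Xu≡1 s) ⟩
      - K * W * (1ℚ * (1ℚ * (u * Xs - 1ℚ * 1ℚ)))
    ≡⟨ solve 4 (λ k w u x → (:- k) :* w :* (con 1ℚ :* (con 1ℚ :* (u :* x :- con 1ℚ :* con 1ℚ)))
                          := k :* w :* (con 1ℚ :- x :* (u :* con 1ℚ))) refl K W u Xs ⟩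
      K * W * (1ℚ - Xs * (u * 1ℚ))
    ≡⟨ sym (cong₂ (λ p q → K * p * (1ℚ - q)) (Y-power k s) (X-power s)) ⟩
      summand M k s K X ∎
    where
    open ≡-Reasoning
    Yk vs Xk uk Xs us sk ss K W : ℚ
    Yk = Y ^ℕ k
    vs = v ^ℕ s
    Xk = X ^ℕ k
    uk = u ^ℕ k
    Xs = X ^ℕ s
    us = u ^ℕ s
    sk = sgn k
    ss = sgn s
    K = sk * ss * c
    W = Yk * (v * vs)

summand-symmetry : ∀ M .{{_ : NonZero M}} X → X ≢ 0ℚ → X ≢ 1ℚ → ∀ k s c ε →
  (s ≢ 1 → ε * (sgn k * sgn s * c) ≡ c) →
  summand M k s c X ≡ (ε * X ^ℤ (pos k ℤ.- pos 2)) * summand M k s c (inv X)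
summand-symmetry M X X≢0 X≢1 k s c ε sign-condition with s ℕ.≟ 1
... | yes refl = begin
    summand M k 1 c X                                       ≡⟨ summand-1≡0 M k c X ⟩
    0ℚ                                                      ≡⟨ sym (ℚP.*-zeroʳ (ε * X ^ℤ (pos k ℤ.- pos 2))) ⟩
    (ε * X ^ℤ (pos k ℤ.- pos 2)) * 0ℚ                       ≡⟨ cong (ε * X ^ℤ (pos k ℤ.- pos 2) *_) (sym (summand-1≡0 M k c (inv X))) ⟩
    (ε * X ^ℤ (pos k ℤ.- pos 2)) * summand M k 1 c (inv X) ∎
  where open ≡-Reasoning
... | no s≢1 = begin
    summand M k s c X                                       ≡⟨ cong (λ z → summand M k s z X) (sym (sign-condition s≢1)) ⟩
    summand M k s (ε * (sgn k * sgn s * c)) X               ≡⟨ summand-scale M k s ε _ X ⟩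
    ε * summand M k s (sgn k * sgn s * c) X                 ≡⟨ cong (ε *_) (sym (summand-inversion k s c)) ⟩
    ε * (X ^ℤ (pos k ℤ.- pos 2) * summand M k s c (inv X))  ≡⟨ sym (ℚP.*-assoc ε _ _) ⟩
    (ε * X ^ℤ (pos k ℤ.- pos 2)) * summand M k s c (inv X) ∎
  where
  open ≡-Reasoning
  open Inversion M X X≢0 X≢1 using (summand-inversion)

-- The coefficient condition

-- For c = a · b with a, b of parities η, ε (off degree 1), t + s = k, ε² = 1 and η ε = (-1)ᵏ:
-- ε (-1)^{k+s} a b = a b whenever s ≠ 1.  If t ≠ 1 the parity of b suffices; if t = 1
-- then (-1)^{k+s} = -1 and the parity of a gives ε a = -a.
coefficient-condition : ∀ k s t (ε η a b : ℚ) → t ℕ.+ s ≡ k → ε * ε ≡ 1ℚ → η * ε ≡ sgn k →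
  (t ≢ 1 → sgn t * b ≡ ε * b) → (s ≢ 1 → sgn s * a ≡ η * a) → s ≢ 1 →
  ε * (sgn k * sgn s * (a * b)) ≡ a * b
coefficient-condition _ s t ε η a b refl εε≡1 ηε≡sgn parity-b parity-a s≢1 with t ℕ.≟ 1
... | no t≢1 = begin
    ε * (sgn (t ℕ.+ s) * sgn s * (a * b))
  ≡⟨ cong (λ z → ε * (z * sgn s * (a * b))) (sgn-+ t s) ⟩
    ε * (sgn t * sgn s * sgn s * (a * b))
  ≡⟨ solve 5 (λ e p q a b → e :* (p :* q :* q :* (a :* b)) := (q :* q) :* (a :* (e :* (p :* b)))) refl
             ε (sgn t) (sgn s) a b ⟩
    (sgn s * sgn s) * (a * (ε * (sgn t * b)))
  ≡⟨ cong₂ (λ p q → p * (a * (ε * q))) (sgn-sq s) (parity-b t≢1) ⟩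
    1ℚ * (a * (ε * (ε * b)))
  ≡⟨ solve 3 (λ e a b → con 1ℚ :* (a :* (e :* (e :* b))) := (e :* e) :* (a :* b)) refl ε a b ⟩
    (ε * ε) * (a * b)
  ≡⟨ trans (cong (_* (a * b)) εε≡1) (ℚP.*-identityˡ _) ⟩
    a * b ∎
  where open ≡-Reasoning
... | yes refl = begin
    ε * (- sgn s * sgn s * (a * b))
  ≡⟨ solve 4 (λ e q a b → e :* ((:- q) :* q :* (a :* b)) := :- (q :* (e :* (q :* a))) :* b) refl ε (sgn s) a b ⟩
    - (sgn s * (ε * (sgn s * a))) * b
  ≡⟨ cong (λ z → - (sgn s * (ε * z)) * b) (parity-a s≢1) ⟩
    - (sgn s * (ε * (η * a))) * b
  ≡⟨ solve 5 (λ q e h a b → :- (q :* (e :* (h :* a))) :* b := :- (q :* ((h :* e) :* a)) :* b) refl (sgn s) ε η a b ⟩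
    - (sgn s * ((η * ε) * a)) * b
  ≡⟨ cong (λ z → - (sgn s * (z * a)) * b) ηε≡sgn ⟩
    - (sgn s * (- sgn s * a)) * b
  ≡⟨ solve 3 (λ q a b → :- (q :* ((:- q) :* a)) :* b := (q :* q) :* (a :* b)) refl (sgn s) a b ⟩
    (sgn s * sgn s) * (a * b)
  ≡⟨ trans (cong (_* (a * b)) (sgn-sq s)) (ℚP.*-identityˡ _) ⟩
    a * b ∎
  where open ≡-Reasoning

proposition4 : (k : ℕ) → .{{_ : NonZero k}}
    → (L M : ℕ) → .{{_ : NonZero L}} → .{{_ : NonZero M}}
    → (χ ψ : ℤ → ℚ)
    → IsDirichletCharacter L χ → IsDirichletCharacter M ψ
    → (Bχ Bψ : ℕ → ℚ) → IsGenBernoulli L χ Bχ → IsGenBernoulli M ψ Bψ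
    → χ -[1+ 0 ] * ψ -[1+ 0 ] ≡ (- 1ℚ) ^ℕ k
    → (X : ℚ) → X ≢ 0ℚ → X ≢ 1ℚ
    → R k Bχ Bψ M X
    ≡ ψ -[1+ 0 ] * (X ^ℤ (pos k ℤ.- pos 2)) * R k Bχ Bψ M (inv X)
proposition4 k L M χ ψ isχ isψ Bχ Bψ isBχ isBψ χψ≡±1 X X≢0 X≢1 = begin
    R k Bχ Bψ M X
  ≡⟨ Σ₀≡Σ< k (λ s → summand M k s (c s) X) ⟩
    Σ< (suc k) (λ s → summand M k s (c s) X)
  ≡⟨ Σ<-cong (suc k) (λ s s<1+k → summand-symmetry M X X≢0 X≢1 k s (c s) (ψ -[1+ 0 ])
                                     (sign-condition s (ℕP.≤-pred s<1+k))) ⟩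
    Σ< (suc k) (λ s → Z * summand M k s (c s) (inv X))
  ≡⟨ Σ<-*ˡ (suc k) Z (λ s → summand M k s (c s) (inv X)) ⟩
    Z * Σ< (suc k) (λ s → summand M k s (c s) (inv X))
  ≡⟨ cong (Z *_) (sym (Σ₀≡Σ< k (λ s → summand M k s (c s) (inv X)))) ⟩
    Z * R k Bχ Bψ M (inv X) ∎
  where
  open ≡-Reasoning
  open Parity L χ isχ Bχ isBχ using () renaming (F to Fχ; parity to parityχ)
  open Parity M ψ isψ Bψ isBψ using () renaming (F to Fψ; parity to parityψ)
  Z : ℚ
  Z = ψ -[1+ 0 ] * X ^ℤ (pos k ℤ.- pos 2)
  c : ℕ → ℚ
  c s = Fχ s * Fψ (k ℕ.∸ s)
  ψ₋₁²≡1 : ψ -[1+ 0 ] * ψ -[1+ 0 ] ≡ 1ℚ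
  ψ₋₁²≡1 = trans (sym (IsDirichletCharacter.multiplicative isψ -[1+ 0 ] -[1+ 0 ]))
                 (IsDirichletCharacter.one isψ)
  sign-condition : ∀ s → s ≤ k → s ≢ 1 → ψ -[1+ 0 ] * (sgn k * sgn s * c s) ≡ c s
  sign-condition s s≤k = coefficient-condition k s (k ℕ.∸ s) (ψ -[1+ 0 ]) (χ -[1+ 0 ]) (Fχ s) (Fψ (k ℕ.∸ s))
    (ℕP.m∸n+n≡m s≤k) ψ₋₁²≡1 (trans χψ≡±1 (sgn≡-1^ k)) (parityψ (k ℕ.∸ s)) (parityχ s)
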